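{- Let $(R,+,\times)$ be a ring with identity and let $G$ be a finite subgroup of the multiplicative monoid $(R,\times)$ with $k=|G|$. If $(G-1)\setminus\{0\}\subseteq R^\times$, then $-1\in G$ if and only if $2\mid k$ or the characteristic of $R$ is $2$.
   Context: $G-1=\{g-1\mid g\in G\}$ and $R^\times$ denotes the set of invertible elements of $(R,\times)$. -}

module Defs where

open import Level using (Level; _⊔_)
open import Data.Nat using (ℕ)
open import Data.Fin using (Fin)
open import Data.Product using (Σ; ∃; _×_)
open import Relation.Binary.PropositionalEquality using (_≡_)
open import Relation.Nullary using (¬_)
open import Algebra.Bundles using (Ring)

module _ {c ℓ : Level} (R : Ring c ℓ) where
  open Ring R

  IsUnit : Carrier → Set (c ⊔ ℓ)
  IsUnit x = Σ Carrier λ y → (x * y ≈ 1#) × (y * x ≈ 1#)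

  CharTwo : Set ℓ
  CharTwo = (1# + 1# ≈ 0#) × ¬ (1# ≈ 0#)

  -- A finite subgroup G of the multiplicative monoid (R, ×) with |G| = k,
  -- given by an enumeration of its elements without repetition (up to ≈).
  record FiniteSubgroup (k : ℕ) : Set (c ⊔ ℓ) where
    field
      elem      : Fin k → Carrier
      distinct  : ∀ i j → elem i ≈ elem j → i ≡ j
      has-one   : ∃ λ i → elem i ≈ 1#
      mul-closed : ∀ i j → ∃ λ m → elem m ≈ elem i * elem j
      inv-closed : ∀ i → ∃ λ j → (elem i * elem j ≈ 1#) × (elem j * elem i ≈ 1#)

    _∈G : Carrier → Set ℓ
    x ∈G = ∃ λ i → elem i ≈ x

-- Multiplication by −1 and inversion are involutions of G, and an involution of a finite
-- set has as many fixed points as the set has elements, modulo 2. If −1 ∈ G and −1 ≠ 1,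
-- multiplication by −1 has no fixed point, since x = −x for a unit x forces 1 + 1 = 0,
-- i.e. −1 = 1; so k is even. Conversely, if k is even then inversion, which fixes 1, fixes
-- some x ≠ 1; then (x − 1)(x + 1) = x² − 1 = 0 with x − 1 a unit, so x = −1. In
-- characteristic 2, −1 = 1 ∈ G.
module Submission where

open import Defs
open import Level using (Level)
open import Algebra.Bundles using (Ring)
open import Data.Nat using (ℕ)
open import Data.Nat.Divisibility using (_∣_)
open import Data.Fin using (Fin)
open import Data.Fin.Properties using (_≟_)
open import Data.Product using (_,_; proj₁; proj₂)
open import Data.Sum using (_⊎_; inj₁; inj₂)
open import Function using (_∘_)
open import Function.Bundles using (_⇔_; mk⇔)
open import Relation.Nullary using (¬_; yes; no)
open import Relation.Binary.PropositionalEquality as ≡ using (_≡_; _≢_)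

module Involution where

  open import Data.Nat using (suc)
  open import Data.Nat.Divisibility using (_∣0; ∣-refl; ∣m∣n⇒∣m+n; ∣m+n∣m⇒∣n; ∣1⇒≡1)
  open import Data.Nat.Properties using (suc-injective; +-comm)
  open import Data.Fin.Properties using (any?)
  open import Data.List using (List; []; _∷_; length; filter; allFin)
  open import Data.List.Properties using (filter-accept; filter-reject; filter-all; length-tabulate)
  open import Data.List.Membership.Propositional using (_∈_)
  open import Data.List.Membership.Propositional.Properties using (∈-filter⁺; ∈-filter⁻; ∈-allFin)
  open import Data.List.Relation.Unary.Any using (here; there)
  import Data.List.Relation.Unary.All as All
  open import Data.List.Relation.Unary.AllPairs using (_∷_)
  open import Data.List.Relation.Unary.Unique.Propositional using (Unique)
  open import Data.List.Relation.Unary.Unique.Propositional.Properties using (filter⁺; allFin⁺)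
  open import Data.Product using (∃; _×_)
  open import Relation.Nullary using (¬?; Dec; contradiction)
  open import Relation.Nullary.Decidable using (_×-dec_)
  open import Relation.Binary.Definitions using (DecidableEquality)
  open import Relation.Binary.PropositionalEquality
    using (refl; sym; trans; cong; subst; ≢-sym; module ≡-Reasoning)

  2∣n⇒2∤1+n : ∀ {n} → 2 ∣ n → ¬ 2 ∣ suc n
  2∣n⇒2∤1+n {n} 2∣n 2∣1+n with ∣1⇒≡1 (∣m+n∣m⇒∣n (subst (2 ∣_) (+-comm 1 n) 2∣1+n) 2∣n)
  ... | ()

  module _ {a} {A : Set a} (_≟_ : DecidableEquality A) where

    _≢?_ : (y x : A) → Dec (y ≢ x)
    y ≢? x = ¬? (y ≟ x)

    _without_ : List A → A → List A
    xs without x = filter (_≢? x) xs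

    ∈-without⁺ : ∀ {x y xs} → y ∈ xs → y ≢ x → y ∈ xs without x
    ∈-without⁺ {x} = ∈-filter⁺ (_≢? x)

    ∈-without⁻ : ∀ {x y xs} → y ∈ xs without x → y ∈ xs × y ≢ x
    ∈-without⁻ {x} = ∈-filter⁻ (_≢? x)

    without-unique : ∀ {x xs} → Unique xs → Unique (xs without x)
    without-unique {x} = filter⁺ (_≢? x)

    length-without : ∀ {x xs} → Unique xs → x ∈ xs → length xs ≡ suc (length (xs without x))
    length-without {x} {x ∷ ys} (x≢ys ∷ _) (here refl) = cong (suc ∘ length) (sym (begin
      (x ∷ ys) without x ≡⟨ filter-reject (_≢? x) (λ x≢x → x≢x refl) ⟩
      ys without x       ≡⟨ filter-all (_≢? x) (All.map ≢-sym x≢ys) ⟩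
      ys                 ∎))
      where open ≡-Reasoning
    length-without {x} {y ∷ ys} (y≢ys ∷ u) (there x∈ys) = cong suc (begin
      length ys                  ≡⟨ length-without u x∈ys ⟩
      suc (length (ys without x)) ≡⟨ cong length (filter-accept (_≢? x) (All.lookup y≢ys x∈ys)) ⟨
      length ((y ∷ ys) without x) ∎)
      where open ≡-Reasoning

    module _ {f : A → A} (f-involutive : ∀ x → f (f x) ≡ x) where

      Closed : List A → Set a
      Closed xs = ∀ {y} → y ∈ xs → f y ∈ xs

      FixedPointFree : List A → Set a
      FixedPointFree xs = ∀ {y} → y ∈ xs → f y ≢ y

      f-transpose : ∀ {x y} → f y ≡ x → y ≡ f x
      f-transpose {y = y} fy≡x = trans (sym (f-involutive y)) (cong f fy≡x)

      f-injective : ∀ {x y} → f y ≡ f x → y ≡ x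
      f-injective {x} fy≡fx = trans (f-transpose fy≡fx) (f-involutive x)

      _withoutOrbit_ : List A → A → List A
      xs withoutOrbit x = (xs without x) without f x

      ∈-withoutOrbit⁻ : ∀ {x y xs} → y ∈ xs withoutOrbit x → y ∈ xs × y ≢ x × y ≢ f x
      ∈-withoutOrbit⁻ y∈ with ∈-without⁻ y∈
      ... | y∈′ , y≢fx with ∈-without⁻ y∈′
      ... | y∈xs , y≢x = y∈xs , y≢x , y≢fx

      withoutOrbit-closed : ∀ {x xs} → Closed xs → Closed (xs withoutOrbit x)
      withoutOrbit-closed closed y∈ with ∈-withoutOrbit⁻ y∈
      ... | y∈xs , y≢x , y≢fx = ∈-without⁺ (∈-without⁺ (closed y∈xs) (y≢fx ∘ f-transpose))
                                           (y≢x ∘ f-injective)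

      length-withoutOrbit : ∀ {x xs} → Unique xs → Closed xs → x ∈ xs → f x ≢ x →
                            length xs ≡ suc (suc (length (xs withoutOrbit x)))
      length-withoutOrbit {x} {xs} u closed x∈xs fx≢x = begin
        length xs                                 ≡⟨ length-without u x∈xs ⟩
        suc (length (xs without x))               ≡⟨ cong suc (length-without (without-unique u) fx∈) ⟩
        suc (suc (length (xs withoutOrbit x)))    ∎
        where
        open ≡-Reasoning
        fx∈ : f x ∈ xs without x
        fx∈ = ∈-without⁺ (closed x∈xs) fx≢x

      -- Recursion on the length n is structural, whereas removing an orbit from xs is not.
      fixedPointFree⇒even : ∀ n xs → length xs ≡ n → Unique xs → Closed xs → FixedPointFree xs → 2 ∣ n
      fixedPointFree⇒even _ [] refl _ _ _ = 2 ∣0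
      fixedPointFree⇒even n (x ∷ xs) len u closed fpf
        with n | sym (trans (sym len) (length-withoutOrbit u closed (here refl) (fpf (here refl))))
      ... | suc (suc m) | len′ = ∣m∣n⇒∣m+n ∣-refl
        (fixedPointFree⇒even m ((x ∷ xs) withoutOrbit x) (suc-injective (suc-injective len′))
          (without-unique (without-unique u)) (withoutOrbit-closed closed) (fpf ∘ proj₁ ∘ ∈-withoutOrbit⁻))

      uniqueFixedPoint⇒odd : ∀ {a xs} → Unique xs → Closed xs → a ∈ xs → f a ≡ a →
                             (∀ {y} → y ∈ xs → f y ≡ y → y ≡ a) → ¬ 2 ∣ length xs
      uniqueFixedPoint⇒odd {a} {xs} u closed a∈xs fa≡a fixed⇒≡a =
        subst (λ n → ¬ 2 ∣ n) (sym (length-without u a∈xs))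
          (2∣n⇒2∤1+n (fixedPointFree⇒even _ (xs without a) refl (without-unique u) closed′ fpf))
        where
        closed′ : Closed (xs without a)
        closed′ y∈ with ∈-without⁻ y∈
        ... | y∈xs , y≢a = ∈-without⁺ (closed y∈xs) (λ fy≡a → y≢a (trans (f-transpose fy≡a) fa≡a))
        fpf : FixedPointFree (xs without a)
        fpf y∈ with ∈-without⁻ y∈
        ... | y∈xs , y≢a = y≢a ∘ fixed⇒≡a y∈xs

  module _ {n} {f : Fin n → Fin n} (f-involutive : ∀ i → f (f i) ≡ i) where

    private
      allFin-closed : Closed _≟_ f-involutive (allFin n)
      allFin-closed {i} _ = ∈-allFin (f i)

    involution-fixedPointFree⇒even : (∀ i → f i ≢ i) → 2 ∣ n
    involution-fixedPointFree⇒even fpf =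
      fixedPointFree⇒even _≟_ f-involutive n (allFin n) (length-tabulate _) (allFin⁺ n)
        allFin-closed (λ {i} _ → fpf i)

    involution-even⇒anotherFixedPoint : 2 ∣ n → ∀ {a} → f a ≡ a → ∃ λ i → f i ≡ i × i ≢ a
    involution-even⇒anotherFixedPoint 2∣n {a} fa≡a with any? (λ i → (f i ≟ i) ×-dec ¬? (i ≟ a))
    ... | yes found = found
    ... | no none = contradiction (subst (2 ∣_) (sym (length-tabulate _)) 2∣n)
      (uniqueFixedPoint⇒odd _≟_ f-involutive (allFin⁺ n) allFin-closed (∈-allFin a) fa≡a fixed⇒≡a)
      where
      fixed⇒≡a : ∀ {i} → i ∈ allFin n → f i ≡ i → i ≡ a
      fixed⇒≡a {i} _ fi≡i with i ≟ a
      ... | yes i≡a = i≡a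
      ... | no i≢a = contradiction (i , fi≡i , i≢a) none

open Involution using (involution-fixedPointFree⇒even; involution-even⇒anotherFixedPoint)

module _ {c ℓ : Level} (R : Ring c ℓ) where

  open Ring R
  open import Algebra.Properties.Ring R using (+-inverseˡ-unique; [y-z]x≈yx-zx)
  open import Algebra.Properties.Monoid *-monoid using (insertˡ; insertʳ)
  open import Relation.Binary.Reasoning.Setoid setoid

  -1≈1⇒1+1≈0 : - 1# ≈ 1# → 1# + 1# ≈ 0#
  -1≈1⇒1+1≈0 -1≈1 = trans (+-congˡ (sym -1≈1)) (-‿inverseʳ 1#)

  1+1≈0⇒-1≈1 : 1# + 1# ≈ 0# → - 1# ≈ 1#
  1+1≈0⇒-1≈1 1+1≈0 = sym (+-inverseˡ-unique 1# 1# 1+1≈0)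

  *-inverse-unique : ∀ {x y z} → y * x ≈ 1# → x * z ≈ 1# → y ≈ z
  *-inverse-unique {x} {y} {z} y*x≈1 x*z≈1 = begin
    y           ≈⟨ insertʳ x*z≈1 y ⟩
    (y * x) * z ≈⟨ *-congʳ y*x≈1 ⟩
    1# * z      ≈⟨ *-identityˡ z ⟩
    z           ∎

  *-cancelˡ-≈0 : ∀ {u a b} → u * a ≈ 1# → a * b ≈ 0# → b ≈ 0#
  *-cancelˡ-≈0 {u} {a} {b} u*a≈1 a*b≈0 = begin
    b           ≈⟨ insertˡ u*a≈1 b ⟩
    u * (a * b) ≈⟨ *-congˡ a*b≈0 ⟩
    u * 0#      ≈⟨ zeroʳ u ⟩
    0#          ∎

  *-cancelʳ-≈0 : ∀ {u a b} → b * a ≈ 0# → a * u ≈ 1# → b ≈ 0#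
  *-cancelʳ-≈0 {u} {a} {b} b*a≈0 a*u≈1 = begin
    b           ≈⟨ insertʳ a*u≈1 b ⟩
    (b * a) * u ≈⟨ *-congʳ b*a≈0 ⟩
    0# * u      ≈⟨ zeroˡ u ⟩
    0#          ∎

  x≈-x⇒1+1≈0 : ∀ {x y} → x * y ≈ 1# → x ≈ - x → 1# + 1# ≈ 0#
  x≈-x⇒1+1≈0 {x} x*y≈1 x≈-x = *-cancelʳ-≈0 [1+1]x≈0 x*y≈1
    where
    [1+1]x≈0 : (1# + 1#) * x ≈ 0#
    [1+1]x≈0 = begin
      (1# + 1#) * x   ≈⟨ distribʳ x 1# 1# ⟩
      1# * x + 1# * x ≈⟨ +-cong (*-identityˡ x) (*-identityˡ x) ⟩
      x + x           ≈⟨ +-congˡ x≈-x ⟩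
      x - x           ≈⟨ -‿inverseʳ x ⟩
      0#              ∎

  x*x≈1⇒[x-1][x+1]≈0 : ∀ {x} → x * x ≈ 1# → (x - 1#) * (x + 1#) ≈ 0#
  x*x≈1⇒[x-1][x+1]≈0 {x} x*x≈1 = begin
    (x - 1#) * (x + 1#)          ≈⟨ [y-z]x≈yx-zx (x + 1#) x 1# ⟩
    x * (x + 1#) - 1# * (x + 1#) ≈⟨ +-cong (distribˡ x x 1#) (-‿cong (*-identityˡ (x + 1#))) ⟩
    (x * x + x * 1#) - (x + 1#)  ≈⟨ +-congʳ (+-cong x*x≈1 (*-identityʳ x)) ⟩
    (1# + x) - (x + 1#)          ≈⟨ +-congʳ (+-comm 1# x) ⟩
    (x + 1#) - (x + 1#)          ≈⟨ -‿inverseʳ (x + 1#) ⟩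
    0#                           ∎

  x*x≈1⇒x≈-1 : ∀ {x} → x * x ≈ 1# → IsUnit R (x - 1#) → x ≈ - 1#
  x*x≈1⇒x≈-1 {x} x*x≈1 (u , _ , u[x-1]≈1) =
    +-inverseˡ-unique x 1# (*-cancelˡ-≈0 u[x-1]≈1 (x*x≈1⇒[x-1][x+1]≈0 x*x≈1))

module _ {c ℓ : Level} {R : Ring c ℓ} {k : ℕ} (G : FiniteSubgroup R k) where

  open Ring R
  open FiniteSubgroup G
  open import Algebra.Properties.Ring R using (-1*x≈-x; -‿involutive; x∙y⁻¹≈ε⇒x≈y)
  open import Algebra.Properties.Monoid *-monoid using (elimˡ)

  one : Fin k
  one = proj₁ has-one

  elem-one : elem one ≈ 1#
  elem-one = proj₂ has-one

  inverse : Fin k → Fin k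
  inverse i = proj₁ (inv-closed i)

  elem-inverseʳ : ∀ i → elem i * elem (inverse i) ≈ 1#
  elem-inverseʳ i = proj₁ (proj₂ (inv-closed i))

  inverse-involutive : ∀ i → inverse (inverse i) ≡ i
  inverse-involutive i = ≡.sym (distinct i (inverse (inverse i))
    (*-inverse-unique R (elem-inverseʳ i) (elem-inverseʳ (inverse i))))

  inverse-one : inverse one ≡ one
  inverse-one = distinct (inverse one) one
    (trans (sym (elimˡ elem-one (elem (inverse one)))) (trans (elem-inverseʳ one) (sym elem-one)))

  inverse-fixed⇒elem²≈1 : ∀ {i} → inverse i ≡ i → elem i * elem i ≈ 1#
  inverse-fixed⇒elem²≈1 {i} inverse-i≡i = ≡.subst (λ j → elem i * elem j ≈ 1#) inverse-i≡i (elem-inverseʳ i)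

  module _ {m : Fin k} (elem-m≈-1 : elem m ≈ - 1#) where

    negate : Fin k → Fin k
    negate i = proj₁ (mul-closed m i)

    elem-negate : ∀ i → elem (negate i) ≈ - elem i
    elem-negate i = trans (proj₂ (mul-closed m i)) (trans (*-congʳ elem-m≈-1) (-1*x≈-x (elem i)))

    negate-involutive : ∀ i → negate (negate i) ≡ i
    negate-involutive i = distinct (negate (negate i)) i
      (trans (elem-negate (negate i)) (trans (-‿cong (elem-negate i)) (-‿involutive (elem i))))

    negate-fixed⇒1+1≈0 : ∀ {i} → negate i ≡ i → 1# + 1# ≈ 0#
    negate-fixed⇒1+1≈0 {i} negate-i≡i =
      x≈-x⇒1+1≈0 R (elem-inverseʳ i) (trans (sym (reflexive (≡.cong elem negate-i≡i))) (elem-negate i))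

  -1∈G⇒2∣k⊎charTwo : ¬ (1# ≈ 0#) → (- 1#) ∈G → (2 ∣ k) ⊎ CharTwo R
  -1∈G⇒2∣k⊎charTwo 1≉0 (m , elem-m≈-1) with m ≟ one
  ... | yes ≡.refl = inj₂ (-1≈1⇒1+1≈0 R (trans (sym elem-m≈-1) elem-one) , 1≉0)
  ... | no m≢one = inj₁ (involution-fixedPointFree⇒even (negate-involutive elem-m≈-1) negate-free)
    where
    negate-free : ∀ i → negate elem-m≈-1 i ≢ i
    negate-free i = m≢one ∘ distinct m one ∘ λ negate-i≡i →
      trans elem-m≈-1 (trans (1+1≈0⇒-1≈1 R (negate-fixed⇒1+1≈0 elem-m≈-1 negate-i≡i)) (sym elem-one))

  2∣k⊎charTwo⇒-1∈G : (∀ i → ¬ (elem i - 1# ≈ 0#) → IsUnit R (elem i - 1#)) →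
                     (2 ∣ k) ⊎ CharTwo R → (- 1#) ∈G
  2∣k⊎charTwo⇒-1∈G _ (inj₂ (1+1≈0 , _)) = one , trans elem-one (sym (1+1≈0⇒-1≈1 R 1+1≈0))
  2∣k⊎charTwo⇒-1∈G units (inj₁ 2∣k)
    with involution-even⇒anotherFixedPoint inverse-involutive 2∣k inverse-one
  ... | i , inverse-i≡i , i≢one =
    i , x*x≈1⇒x≈-1 R (inverse-fixed⇒elem²≈1 inverse-i≡i) (units i elem-i-1≉0)
    where
    elem-i-1≉0 : ¬ (elem i - 1# ≈ 0#)
    elem-i-1≉0 = i≢one ∘ distinct i one ∘ λ elem-i-1≈0 → trans (x∙y⁻¹≈ε⇒x≈y _ _ elem-i-1≈0) (sym elem-one)

lemma7 : {c ℓ : Level} (R : Ring c ℓ) → ¬ (Ring._≈_ R (Ring.1# R) (Ring.0# R)) →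
    (k : ℕ) (G : FiniteSubgroup R k) →
    (∀ i → ¬ (Ring._≈_ R (Ring._-_ R (FiniteSubgroup.elem G i) (Ring.1# R)) (Ring.0# R)) →
      IsUnit R (Ring._-_ R (FiniteSubgroup.elem G i) (Ring.1# R))) →
    (FiniteSubgroup._∈G G (Ring.-_ R (Ring.1# R)) ⇔ ((2 ∣ k) ⊎ CharTwo R))
lemma7 R 1≉0 k G units = mk⇔ (-1∈G⇒2∣k⊎charTwo G 1≉0) (2∣k⊎charTwo⇒-1∈G G units)
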